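{- Let $\lambda$ be a nonzero real number, $n\ge0$ an integer, and $p(x)\in\mathbb{C}[x]$ a polynomial of degree at most $n$. Then $$p(x)=\sum_{k=0}^{n}C_k\,\phi_{k,\lambda}(x),\qquad\text{where } C_k=\frac{1}{k!}\big\langle(\log_\lambda(1+t))^k\,\big|\,p(x)\big\rangle_\lambda .$$
   Context: For $\lambda\neq 0$: $(x)_{0,\lambda}=1$ and $(x)_{n,\lambda}=x(x-\lambda)\cdots(x-(n-1)\lambda)$ for $n\ge1$. The degenerate exponential is $e_\lambda^{x}(t)=\sum_{k\ge0}(x)_{k,\lambda}\frac{t^k}{k!}=(1+\lambda t)^{x/\lambda}$, $e_\lambda(t)=e_\lambda^1(t)$, and $\log_\lambda$ is its compositional inverse, so $\log_\lambda(1+t)=\frac{1}{\lambda}\big((1+t)^\lambda-1\big)$. For a formal power series $f(t)=\sum_{k\ge0}a_k\frac{t^k}{k!}$ with complex coefficients, $\langle f(t)\,|\,\cdot\,\rangle_\lambda$ denotes the linear functional on $\mathbb{C}[x]$ determined by $\langle f(t)\,|\,(x)_{k,\lambda}\rangle_\lambda=a_k$ for all $k\ge0$. The fully degenerate Bell polynomials $\phi_{n,\lambda}(x)$ are defined by $e_\lambda^{x}\big(e_\lambda(t)-1\big)=\sum_{n\ge0}\phi_{n,\lambda}(x)\frac{t^n}{n!}$. -}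

module Defs where

open import Level using (Level; _⊔_) renaming (suc to lsuc)
open import Algebra.Bundles using (CommutativeRing)
open import Data.Nat as ℕ using (ℕ; zero; suc)
open import Data.Nat.Combinatorics using (_C_)
open import Data.List using (List; []; _∷_; length; map; foldr; upTo)
open import Relation.Nullary using (¬_)

ringFromℕ : ∀ {c ℓ} (R : CommutativeRing c ℓ) → ℕ → CommutativeRing.Carrier R
ringFromℕ R zero    = CommutativeRing.0# R
ringFromℕ R (suc n) = CommutativeRing._+_ R (CommutativeRing.1# R) (ringFromℕ R n)

-- A field of characteristic zero (the paper works over ℂ).
-- The inverse is a total function, required to be a right inverse on
-- nonzero elements (commutativity makes it two-sided).
record CharZeroField (c ℓ : Level) : Set (lsuc (c ⊔ ℓ)) where
  field
    commutativeRing : CommutativeRing c ℓ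
  open CommutativeRing commutativeRing public
  field
    _⁻¹      : Carrier → Carrier
    inverseʳ : ∀ x → ¬ (x ≈ 0#) → (x * (x ⁻¹)) ≈ 1#
    charZero : ∀ n → ¬ (ringFromℕ commutativeRing (suc n) ≈ 0#)

  fromℕ : ℕ → Carrier
  fromℕ = ringFromℕ commutativeRing

module Ops {c ℓ : Level} (F : CharZeroField c ℓ) where
  open CharZeroField F public

  -- Polynomials in K[x]: lists of coefficients, constant term first.
  Poly : Set c
  Poly = List Carrier

  coeff : Poly → ℕ → Carrier
  coeff []       _       = 0#
  coeff (a ∷ p)  zero    = a
  coeff (a ∷ p)  (suc i) = coeff p i

  -- equality of polynomials (coefficientwise, trailing zeros ignored)
  _≈ₚ_ : Poly → Poly → Set ℓ
  p ≈ₚ q = ∀ i → coeff p i ≈ coeff q i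

  _+ₚ_ : Poly → Poly → Poly
  []      +ₚ q       = q
  (a ∷ p) +ₚ []      = a ∷ p
  (a ∷ p) +ₚ (b ∷ q) = (a + b) ∷ (p +ₚ q)

  _·ₚ_ : Carrier → Poly → Poly
  a ·ₚ p = map (a *_) p

  sumₚ : List Poly → Poly
  sumₚ = foldr _+ₚ_ []

  mulXminus : Carrier → Poly → Poly
  mulXminus a p = (0# ∷ p) +ₚ ((- a) ·ₚ p)

  fallPoly : Carrier → ℕ → Poly
  fallPoly lam zero    = 1# ∷ []
  fallPoly lam (suc k) = mulXminus (fromℕ k * lam) (fallPoly lam k)

  -- Coordinates of a polynomial in the basis ((x)_{k,λ})_k.
  -- Uses x·(x)_{k,λ} = (x)_{k+1,λ} + kλ (x)_{k,λ} and Horner's scheme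
  -- p = a₀ + x·q.
  mulXcoords : Carrier → List Carrier → List Carrier
  mulXcoords lam cs = go 0 (0# ∷ cs)
    where
      -- output coordinate j is c_{j-1} + jλ c_j
      go : ℕ → List Carrier → List Carrier
      go j []       = []
      go j (d ∷ ds) = (d + (fromℕ j * lam) * coeff cs j) ∷ go (suc j) ds

  fallCoords : Carrier → Poly → List Carrier
  fallCoords lam []      = []
  fallCoords lam (a ∷ q) = (a ∷ []) +ₚ mulXcoords lam (fallCoords lam q)

  -- Formal power series f(t) = Σ a_k t^k / k!, given by (a_k)_k.
  Series : Set c
  Series = ℕ → Carrier

  sumTo : ℕ → (ℕ → Carrier) → Carrier
  sumTo zero    f = f 0
  sumTo (suc n) f = sumTo n f + f (suc n)

  _⊛_ : Series → Series → Series
  (f ⊛ g) n = sumTo n (λ i → fromℕ (n C i) * (f i * g (n ℕ.∸ i)))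

  oneS : Series
  oneS zero    = 1#
  oneS (suc _) = 0#

  _^S_ : Series → ℕ → Series
  f ^S zero  = oneS
  f ^S suc k = f ⊛ (f ^S k)

  -- the functional ⟨ f(t) | · ⟩_λ : ⟨ f | (x)_{k,λ} ⟩_λ = a_k, extended linearly
  pairing : Carrier → Series → Poly → Carrier
  pairing lam f p = go 0 (fallCoords lam p)
    where
      go : ℕ → List Carrier → Carrier
      go k []       = 0#
      go k (c ∷ cs) = f k * c + go (suc k) cs

  fall : Carrier → Carrier → ℕ → Carrier
  fall x lam zero    = 1#
  fall x lam (suc k) = fall x lam k * (x - fromℕ k * lam)

  -- (1+t)^λ = Σ (λ)_{j,1} t^j/j!, so
  -- log_λ(1+t) = λ⁻¹((1+t)^λ - 1) has coefficients:
  logλ : Carrier → Series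
  logλ lam zero    = (lam ⁻¹) * (fall lam 1# 0 - 1#)
  logλ lam (suc j) = (lam ⁻¹) * fall lam 1# (suc j)

  -- e_λ(t) - 1 = Σ_{j≥1} (1)_{j,λ} t^j / j!
  eλm1 : Carrier → Series
  eλm1 lam zero    = 0#
  eλm1 lam (suc j) = fall 1# lam (suc j)

  factInv : ℕ → Carrier
  factInv k = fromℕ (k ℕ.!) ⁻¹

  -- fully degenerate Bell polynomial:
  -- e_λ^x(e_λ(t)-1) = Σ_k (x)_{k,λ} (e_λ(t)-1)^k / k!, coefficient of t^n/n!
  -- (terms with k > n vanish since (e_λ(t)-1)^k has order k)
  φ : Carrier → ℕ → Poly
  φ lam n = sumₚ (map (λ k → (factInv k * (eλm1 lam ^S k) n) ·ₚ fallPoly lam k)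
                      (upTo (suc n)))

  Ccoef : Carrier → ℕ → Poly → Carrier
  Ccoef lam k p = factInv k * pairing lam (logλ lam ^S k) p

{-# OPTIONS --safe #-}
module Submission where

-- Write p in the basis of degenerate falling factorials, p = Σⱼ cⱼ (x)_{j,λ}, so that
-- ⟨f | p⟩_λ = Σⱼ fⱼ cⱼ. With S₂(k,m) the coefficient of t^k/k! in (e_λ(t) − 1)^m/m! and
-- S₁(j,k) that of t^j/j! in (log_λ(1+t))^k/k!, this gives C_k = Σⱼ cⱼ S₁(j,k) and
-- φ_k = Σ_m S₂(k,m) (x)_{m,λ}, hence Σ_k C_k φ_k = Σ_{j,m} cⱼ (S₁S₂)(j,m) (x)_{m,λ} = p
-- once S₁S₂ = I. That inversion is proved without composing series: E = e_λ(t) − 1 and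
-- L = log_λ(1+t) satisfy (1 + λt) E′ = 1 + E and (1 + t) L′ = 1 + λL, which give
-- triangular recurrences for the columns of both matrices, and S₁S₂ = I follows from
-- them by induction.

open import Defs
open import Algebra.Bundles using (CommutativeRing)
open import Data.Nat as ℕ using (ℕ; zero; suc; _≤_; _<_; s≤s; _∸_)
import Data.Nat.Properties as ℕP
open import Data.Nat.Combinatorics using (_C_; nCk+nC[k+1]≡[n+1]C[k+1]; k>n⇒nCk≡0)
open import Data.List using (List; []; _∷_; length; map; upTo; applyUpTo)
open import Data.Sum using (inj₁; inj₂)
open import Function using (_∘_)
open import Relation.Nullary using (¬_; yes; no)
open import Data.Empty using (⊥-elim)
open import Relation.Binary.PropositionalEquality as ≡ using (_≡_; _≢_)

module CommutativeRingProperties {c ℓ} (R : CommutativeRing c ℓ) where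
  open CommutativeRing R
  open import Relation.Binary.Reasoning.Setoid setoid
  open import Algebra.Definitions.RawMonoid +-rawMonoid using (_×_)
  open import Algebra.Properties.Semiring.Mult semiring using (×-homo-+; ×1-homo-*)
  open import Algebra.Properties.Ring ring using (-‿distribˡ-*)
  open import Algebra.Solver.Ring.NaturalCoefficients.Default commutativeSemiring
    using (solve; _:=_; _:+_; _:*_)

  ≡⇒≈ : ∀ {x y} → x ≡ y → x ≈ y
  ≡⇒≈ ≡.refl = refl

  ringFromℕ≡×1# : ∀ n → ringFromℕ R n ≡ n × 1#
  ringFromℕ≡×1# zero    = ≡.refl
  ringFromℕ≡×1# (suc n) = ≡.cong (1# +_) (ringFromℕ≡×1# n)

  ringFromℕ-+ : ∀ m n → ringFromℕ R (m ℕ.+ n) ≈ ringFromℕ R m + ringFromℕ R n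
  ringFromℕ-+ m n rewrite ringFromℕ≡×1# (m ℕ.+ n) | ringFromℕ≡×1# m | ringFromℕ≡×1# n = ×-homo-+ 1# m n

  ringFromℕ-* : ∀ m n → ringFromℕ R (m ℕ.* n) ≈ ringFromℕ R m * ringFromℕ R n
  ringFromℕ-* m n rewrite ringFromℕ≡×1# (m ℕ.* n) | ringFromℕ≡×1# m | ringFromℕ≡×1# n = ×1-homo-* m n

  -x*y+x*y≈0 : ∀ x y → (- x) * y + x * y ≈ 0#
  -x*y+x*y≈0 x y = trans (+-congʳ (sym (-‿distribˡ-* x y))) (-‿inverseˡ (x * y))

  x[y+-a]+a*x≈x*y : ∀ x y a → x * (y + - a) + a * x ≈ x * y
  x[y+-a]+a*x≈x*y x y a = begin
    x * (y + - a) + a * x         ≈⟨ solve 4 (λ x y n a → x :* (y :+ n) :+ a :* x := x :* y :+ (n :* x :+ a :* x)) refl x y (- a) a ⟩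
    x * y + ((- a) * x + a * x)   ≈⟨ +-congˡ (-x*y+x*y≈0 a x) ⟩
    x * y + 0#                    ≈⟨ +-identityʳ _ ⟩
    x * y                         ∎

  x+y≈0∧y≈0⇒x≈0 : ∀ {x y} → x + y ≈ 0# → y ≈ 0# → x ≈ 0#
  x+y≈0∧y≈0⇒x≈0 {x} {y} x+y≈0 y≈0 = begin
    x      ≈⟨ +-identityʳ x ⟨
    x + 0# ≈⟨ +-congˡ y≈0 ⟨
    x + y  ≈⟨ x+y≈0 ⟩
    0#     ∎

  ∑< : ℕ → (ℕ → Carrier) → Carrier
  ∑< zero    f = 0#
  ∑< (suc n) f = ∑< n f + f n

  syntax ∑< n (λ k → e) = ∑[ k < n ] e

  ∑-cong< : ∀ n {f g : ℕ → Carrier} → (∀ k → k < n → f k ≈ g k) → ∑< n f ≈ ∑< n g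
  ∑-cong< zero    f≈g = refl
  ∑-cong< (suc n) f≈g = +-cong (∑-cong< n (λ k k<n → f≈g k (ℕP.m<n⇒m<1+n k<n))) (f≈g n ℕP.≤-refl)

  ∑-cong : ∀ n {f g : ℕ → Carrier} → (∀ k → f k ≈ g k) → ∑< n f ≈ ∑< n g
  ∑-cong n f≈g = ∑-cong< n (λ k _ → f≈g k)

  ∑-zero : ∀ n {f : ℕ → Carrier} → (∀ k → k < n → f k ≈ 0#) → ∑< n f ≈ 0#
  ∑-zero zero    f≈0 = refl
  ∑-zero (suc n) f≈0 =
    trans (+-cong (∑-zero n (λ k k<n → f≈0 k (ℕP.m<n⇒m<1+n k<n))) (f≈0 n ℕP.≤-refl)) (+-identityʳ 0#)

  ∑-distrib-+ : ∀ n (f g : ℕ → Carrier) → ∑[ k < n ] (f k + g k) ≈ ∑< n f + ∑< n g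
  ∑-distrib-+ zero    f g = sym (+-identityʳ 0#)
  ∑-distrib-+ (suc n) f g = begin
    ∑[ k < n ] (f k + g k) + (f n + g n) ≈⟨ +-congʳ (∑-distrib-+ n f g) ⟩
    (∑< n f + ∑< n g) + (f n + g n)      ≈⟨ +-assoc _ _ _ ⟩
    ∑< n f + (∑< n g + (f n + g n))      ≈⟨ +-congˡ (+-comm _ _) ⟩
    ∑< n f + ((f n + g n) + ∑< n g)      ≈⟨ +-congˡ (+-assoc _ _ _) ⟩
    ∑< n f + (f n + (g n + ∑< n g))      ≈⟨ +-assoc _ _ _ ⟨
    (∑< n f + f n) + (g n + ∑< n g)      ≈⟨ +-congˡ (+-comm _ _) ⟩
    (∑< n f + f n) + (∑< n g + g n)      ∎

  ∑-distribˡ-* : ∀ n x (f : ℕ → Carrier) → x * ∑< n f ≈ ∑[ k < n ] (x * f k)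
  ∑-distribˡ-* zero    x f = zeroʳ x
  ∑-distribˡ-* (suc n) x f = trans (distribˡ x _ _) (+-congʳ (∑-distribˡ-* n x f))

  ∑-distribʳ-* : ∀ n x (f : ℕ → Carrier) → ∑< n f * x ≈ ∑[ k < n ] (f k * x)
  ∑-distribʳ-* n x f =
    trans (*-comm _ x) (trans (∑-distribˡ-* n x f) (∑-cong n (λ k → *-comm x (f k))))

  ∑-head : ∀ n (f : ℕ → Carrier) → ∑< (suc n) f ≈ f 0 + ∑< n (f ∘ suc)
  ∑-head zero    f = trans (+-identityˡ _) (sym (+-identityʳ _))
  ∑-head (suc n) f = trans (+-congʳ (∑-head n f)) (+-assoc _ _ _)

  ∑-comm : ∀ m n (f : ℕ → ℕ → Carrier) → ∑[ i < m ] ∑[ j < n ] f i j ≈ ∑[ j < n ] ∑[ i < m ] f i j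
  ∑-comm zero    n f = sym (∑-zero n (λ _ _ → refl))
  ∑-comm (suc m) n f =
    trans (+-congʳ (∑-comm m n f)) (sym (∑-distrib-+ n (λ j → ∑[ i < m ] f i j) (f m)))

  ∑-sandwich : ∀ N (x y : ℕ → Carrier) (a b : ℕ → ℕ → Carrier) →
    ∑[ k < N ] ((∑[ j < N ] (b j k * x j)) * (∑[ m < N ] (a k m * y m)))
      ≈ ∑[ j < N ] ∑[ m < N ] ((x j * y m) * ∑[ k < N ] (a k m * b j k))
  ∑-sandwich N x y a b = begin
    ∑[ k < N ] ((∑[ j < N ] (b j k * x j)) * (∑[ m < N ] (a k m * y m)))
      ≈⟨ ∑-cong N (λ k → trans (∑-distribʳ-* N _ _) (∑-cong N (λ j → ∑-distribˡ-* N _ _))) ⟩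
    ∑[ k < N ] ∑[ j < N ] ∑[ m < N ] ((b j k * x j) * (a k m * y m))
      ≈⟨ ∑-comm N N _ ⟩
    ∑[ j < N ] ∑[ k < N ] ∑[ m < N ] ((b j k * x j) * (a k m * y m))
      ≈⟨ ∑-cong N (λ j → ∑-comm N N _) ⟩
    ∑[ j < N ] ∑[ m < N ] ∑[ k < N ] ((b j k * x j) * (a k m * y m))
      ≈⟨ ∑-cong N (λ j → ∑-cong N (λ m → ∑-cong N (λ k →
           solve 4 (λ b x a y → (b :* x) :* (a :* y) := (x :* y) :* (a :* b)) refl (b j k) (x j) (a k m) (y m)))) ⟩
    ∑[ j < N ] ∑[ m < N ] ∑[ k < N ] ((x j * y m) * (a k m * b j k))
      ≈⟨ ∑-cong N (λ j → ∑-cong N (λ m → ∑-distribˡ-* N _ _)) ⟨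
    ∑[ j < N ] ∑[ m < N ] ((x j * y m) * ∑[ k < N ] (a k m * b j k))
      ∎

  ∑-extend : ∀ {a b} (f : ℕ → Carrier) → a ≤ b → (∀ k → a ≤ k → k < b → f k ≈ 0#) → ∑< b f ≈ ∑< a f
  ∑-extend {b = zero}  f ℕ.z≤n f≈0 = refl
  ∑-extend {a} {suc b} f a≤1+b f≈0 with ℕP.m≤n⇒m<n∨m≡n a≤1+b
  ... | inj₂ ≡.refl = refl
  ... | inj₁ a<1+b  = begin
    ∑< b f + f b ≈⟨ +-cong (∑-extend f a≤b (λ k a≤k k<b → f≈0 k a≤k (ℕP.m<n⇒m<1+n k<b))) (f≈0 b a≤b ℕP.≤-refl) ⟩
    ∑< a f + 0#  ≈⟨ +-identityʳ _ ⟩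
    ∑< a f       ∎
    where a≤b = ℕP.≤-pred a<1+b

  ∑-support : ∀ a b (f : ℕ → Carrier) → (∀ k → a ≤ k → f k ≈ 0#) → (∀ k → b ≤ k → f k ≈ 0#) → ∑< a f ≈ ∑< b f
  ∑-support a b f fa fb with ℕP.≤-total a b
  ... | inj₁ a≤b = sym (∑-extend f a≤b (λ k a≤k _ → fa k a≤k))
  ... | inj₂ b≤a = ∑-extend f b≤a (λ k b≤k _ → fb k b≤k)

  δ : ℕ → ℕ → Carrier
  δ zero    zero    = 1#
  δ zero    (suc m) = 0#
  δ (suc j) zero    = 0#
  δ (suc j) (suc m) = δ j m

  δ-diag : ∀ j → δ j j ≈ 1#
  δ-diag zero    = refl
  δ-diag (suc j) = δ-diag j

  δ-off : ∀ {j m} → j ≢ m → δ j m ≈ 0#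
  δ-off {zero}  {zero}  j≢m = ⊥-elim (j≢m ≡.refl)
  δ-off {zero}  {suc m} j≢m = refl
  δ-off {suc j} {zero}  j≢m = refl
  δ-off {suc j} {suc m} j≢m = δ-off (j≢m ∘ ≡.cong suc)

  *-δ-swap : ∀ (f : ℕ → Carrier) j m → f j * δ j m ≈ f m * δ j m
  *-δ-swap f j m with j ℕ.≟ m
  ... | yes ≡.refl = refl
  ... | no  j≢m    = trans (*-congˡ (δ-off j≢m)) (trans (zeroʳ _) (sym (trans (*-congˡ (δ-off j≢m)) (zeroʳ _))))

  ∑-δ : ∀ n j (g : ℕ → Carrier) → j < n → ∑[ m < n ] (δ j m * g m) ≈ g j
  ∑-δ (suc n) j g j<1+n with ℕP.m≤n⇒m<n∨m≡n (ℕP.≤-pred j<1+n)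
  ... | inj₁ j<n = begin
    ∑[ m < n ] (δ j m * g m) + δ j n * g n ≈⟨ +-cong (∑-δ n j g j<n) (*-congʳ (δ-off (ℕP.<⇒≢ j<n))) ⟩
    g j + 0# * g n                         ≈⟨ +-congˡ (zeroˡ _) ⟩
    g j + 0#                               ≈⟨ +-identityʳ _ ⟩
    g j                                    ∎
  ... | inj₂ ≡.refl = begin
    ∑[ m < j ] (δ j m * g m) + δ j j * g j ≈⟨ +-cong (∑-zero j below) (*-congʳ (δ-diag j)) ⟩
    0# + 1# * g j                          ≈⟨ +-identityˡ _ ⟩
    1# * g j                               ≈⟨ *-identityˡ _ ⟩
    g j                                    ∎
    where
    below : ∀ m → m < j → δ j m * g m ≈ 0#
    below m m<j = trans (*-congʳ (δ-off (ℕP.<⇒≢ m<j ∘ ≡.sym))) (zeroˡ _)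

module _ {c ℓ} (F : CharZeroField c ℓ) where
  open Ops F hiding (zero)
  open CommutativeRingProperties commutativeRing
  open import Algebra.Properties.Ring ring using (+-cancelʳ; -0#≈0#)
  open import Relation.Binary.Reasoning.Setoid setoid
  open import Algebra.Solver.Ring.NaturalCoefficients.Default commutativeSemiring
    using (solve; _:=_; _:+_; _:*_)

  fromℕ≉0 : ∀ {m} → m ≢ 0 → ¬ (fromℕ m ≈ 0#)
  fromℕ≉0 {zero}  m≢0 = ⊥-elim (m≢0 ≡.refl)
  fromℕ≉0 {suc m} _   = charZero m

  fromℕ-1 : fromℕ 1 ≈ 1#
  fromℕ-1 = +-identityʳ 1#

  inverse-unique : ∀ x {y z} → x * y ≈ 1# → x * z ≈ 1# → y ≈ z
  inverse-unique x {y} {z} xy≈1 xz≈1 = begin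
    y           ≈⟨ *-identityʳ y ⟨
    y * 1#      ≈⟨ *-congˡ xz≈1 ⟨
    y * (x * z) ≈⟨ solve 3 (λ x y z → y :* (x :* z) := (x :* y) :* z) refl x y z ⟩
    (x * y) * z ≈⟨ *-congʳ xy≈1 ⟩
    1# * z      ≈⟨ *-identityˡ z ⟩
    z           ∎

  fromℕ[k!]*factInv[k]≈1 : ∀ k → fromℕ (k ℕ.!) * factInv k ≈ 1#
  fromℕ[k!]*factInv[k]≈1 k = inverseʳ _ (fromℕ≉0 (ℕ.≢-nonZero⁻¹ _ {{ℕP._!≢0 k}}))

  factInv-0 : factInv 0 ≈ 1#
  factInv-0 = inverse-unique (fromℕ 1) (fromℕ[k!]*factInv[k]≈1 0) (trans (*-identityʳ _) fromℕ-1)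

  factInv-suc : ∀ k → factInv (suc k) * fromℕ (suc k) ≈ factInv k
  factInv-suc k = inverse-unique (fromℕ (k ℕ.!)) k!*u*[1+k]≈1 (fromℕ[k!]*factInv[k]≈1 k)
    where
    u = factInv (suc k)
    k!*u*[1+k]≈1 : fromℕ (k ℕ.!) * (u * fromℕ (suc k)) ≈ 1#
    k!*u*[1+k]≈1 = begin
      fromℕ (k ℕ.!) * (u * fromℕ (suc k))  ≈⟨ solve 3 (λ a b u → b :* (u :* a) := (a :* b) :* u) refl (fromℕ (suc k)) (fromℕ (k ℕ.!)) u ⟩
      (fromℕ (suc k) * fromℕ (k ℕ.!)) * u  ≈⟨ *-congʳ (ringFromℕ-* (suc k) (k ℕ.!)) ⟨
      fromℕ (suc k ℕ.!) * u                ≈⟨ fromℕ[k!]*factInv[k]≈1 (suc k) ⟩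
      1#                                   ∎

  infix  4 _≋_
  infixl 6 _⊕_
  infixr 7 _·_

  _≋_ : Series → Series → Set ℓ
  f ≋ g = ∀ n → f n ≈ g n

  _⊕_ : Series → Series → Series
  (f ⊕ g) n = f n + g n

  _·_ : Carrier → Series → Series
  (a · f) n = a * f n

  binomial : ℕ → ℕ → Carrier
  binomial n i = fromℕ (n C i)

  ⊛-unfold : ∀ f g n → (f ⊛ g) n ≈ ∑[ i < suc n ] (binomial n i * (f i * g (n ∸ i)))
  ⊛-unfold f g n = sumTo≈∑ n _
    where
    sumTo≈∑ : ∀ n (t : ℕ → Carrier) → sumTo n t ≈ ∑< (suc n) t
    sumTo≈∑ zero    t = sym (+-identityˡ _)
    sumTo≈∑ (suc n) t = +-congʳ (sumTo≈∑ n t)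

  ⊛-by-terms : ∀ f g {h} (t : ℕ → ℕ → Carrier) → (∀ n → h n ≈ ∑< (suc n) (t n)) →
               (∀ n i → binomial n i * (f i * g (n ∸ i)) ≈ t n i) → f ⊛ g ≋ h
  ⊛-by-terms f g t h≈∑t terms n = trans (⊛-unfold f g n) (trans (∑-cong (suc n) (terms n)) (sym (h≈∑t n)))

  ⊛-cong : ∀ {f f′ g g′} → f ≋ f′ → g ≋ g′ → f ⊛ g ≋ f′ ⊛ g′
  ⊛-cong {f} {f′} {g} {g′} f≋f′ g≋g′ =
    ⊛-by-terms f g _ (⊛-unfold f′ g′) (λ n i → *-congˡ (*-cong (f≋f′ i) (g≋g′ (n ∸ i))))

  ⊛-distribʳ : ∀ f g h → (f ⊕ g) ⊛ h ≋ f ⊛ h ⊕ g ⊛ h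
  ⊛-distribʳ f g h = ⊛-by-terms (f ⊕ g) h (λ n i → binomial n i * (f i * h (n ∸ i)) + binomial n i * (g i * h (n ∸ i)))
    (λ n → trans (+-cong (⊛-unfold f h n) (⊛-unfold g h n)) (sym (∑-distrib-+ (suc n) _ _)))
    (λ n i → solve 4 (λ C a b x → C :* ((a :+ b) :* x) := C :* (a :* x) :+ C :* (b :* x)) refl
                     (binomial n i) (f i) (g i) (h (n ∸ i)))

  ⊛-distribˡ : ∀ f g h → f ⊛ (g ⊕ h) ≋ f ⊛ g ⊕ f ⊛ h
  ⊛-distribˡ f g h = ⊛-by-terms f (g ⊕ h) (λ n i → binomial n i * (f i * g (n ∸ i)) + binomial n i * (f i * h (n ∸ i)))
    (λ n → trans (+-cong (⊛-unfold f g n) (⊛-unfold f h n)) (sym (∑-distrib-+ (suc n) _ _)))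
    (λ n i → solve 4 (λ C x a b → C :* (x :* (a :+ b)) := C :* (x :* a) :+ C :* (x :* b)) refl
                     (binomial n i) (f i) (g (n ∸ i)) (h (n ∸ i)))

  ⊛-·ˡ : ∀ a f g → (a · f) ⊛ g ≋ a · (f ⊛ g)
  ⊛-·ˡ a f g = ⊛-by-terms (a · f) g (λ n i → a * (binomial n i * (f i * g (n ∸ i))))
    (λ n → trans (*-congˡ (⊛-unfold f g n)) (∑-distribˡ-* (suc n) a _))
    (λ n i → solve 4 (λ C a x y → C :* ((a :* x) :* y) := a :* (C :* (x :* y))) refl
                     (binomial n i) a (f i) (g (n ∸ i)))

  ⊛-·ʳ : ∀ a f g → f ⊛ (a · g) ≋ a · (f ⊛ g)
  ⊛-·ʳ a f g = ⊛-by-terms f (a · g) (λ n i → a * (binomial n i * (f i * g (n ∸ i))))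
    (λ n → trans (*-congˡ (⊛-unfold f g n)) (∑-distribˡ-* (suc n) a _))
    (λ n i → solve 4 (λ C a x y → C :* (x :* (a :* y)) := a :* (C :* (x :* y))) refl
                     (binomial n i) a (f i) (g (n ∸ i)))

  ⊛-zeroʳ : ∀ f {g} → g ≋ (λ _ → 0#) → f ⊛ g ≋ (λ _ → 0#)
  ⊛-zeroʳ f {g} g≋0 n = trans (⊛-unfold f g n) (∑-zero (suc n) (λ i _ →
    trans (*-congˡ (trans (*-congˡ (g≋0 (n ∸ i))) (zeroʳ _))) (zeroʳ _)))

  ⊛-identityˡ : ∀ f → oneS ⊛ f ≋ f
  ⊛-identityˡ f n = begin
    (oneS ⊛ f) n                                                   ≈⟨ ⊛-unfold oneS f n ⟩
    ∑[ i < suc n ] (binomial n i * (oneS i * f (n ∸ i)))           ≈⟨ ∑-head n _ ⟩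
    binomial n 0 * (1# * f n) + ∑[ i < n ] (binomial n (suc i) * (0# * f (n ∸ suc i)))
      ≈⟨ +-cong (trans (*-congʳ fromℕ-1) (trans (*-identityˡ _) (*-identityˡ _)))
                (∑-zero n (λ i _ → trans (*-congˡ (zeroˡ _)) (zeroʳ _))) ⟩
    f n + 0#                                                       ≈⟨ +-identityʳ _ ⟩
    f n                                                            ∎

  -- The shift f ∘ suc is the derivative of an exponential generating function.
  ⊛-leibniz : ∀ f g n → (f ⊛ g) (suc n) ≈ ((f ∘ suc) ⊛ g) n + (f ⊛ (g ∘ suc)) n
  ⊛-leibniz f g n = begin
    (f ⊛ g) (suc n)                         ≈⟨ ⊛-unfold f g (suc n) ⟩
    ∑< (suc (suc n)) T                      ≈⟨ ∑-head (suc n) T ⟩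
    T 0 + ∑< (suc n) (T ∘ suc)              ≈⟨ +-congˡ (∑-cong (suc n) pascal) ⟩
    T 0 + ∑[ i < suc n ] (X i + Y i)        ≈⟨ +-congˡ (∑-distrib-+ (suc n) X Y) ⟩
    T 0 + (∑< (suc n) X + ∑< (suc n) Y)     ≈⟨ solve 3 (λ a b c → a :+ (b :+ c) := b :+ (a :+ c)) refl (T 0) _ _ ⟩
    ∑< (suc n) X + (T 0 + ∑< (suc n) Y)     ≈⟨ +-cong (sym (⊛-unfold (f ∘ suc) g n)) T₀+∑Y ⟩
    ((f ∘ suc) ⊛ g) n + (f ⊛ (g ∘ suc)) n   ∎
    where
    T X Y Z : ℕ → Carrier
    T i = binomial (suc n) i * (f i * g (suc n ∸ i))
    X i = binomial n i * (f (suc i) * g (n ∸ i))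
    Y i = binomial n (suc i) * (f (suc i) * g (n ∸ i))
    Z i = binomial n i * (f i * g (suc (n ∸ i)))

    pascal : ∀ i → T (suc i) ≈ X i + Y i
    pascal i = trans (*-congʳ (trans (≡⇒≈ (≡.cong fromℕ (≡.sym (nCk+nC[k+1]≡[n+1]C[k+1] n i))))
                                     (ringFromℕ-+ (n C i) (n C suc i))))
                     (distribʳ _ _ _)

    T₀+∑Y : T 0 + ∑< (suc n) Y ≈ (f ⊛ (g ∘ suc)) n
    T₀+∑Y = begin
      T 0 + ∑< (suc n) Y     ≈⟨ +-congˡ (+-congˡ (trans (*-congʳ (≡⇒≈ (≡.cong fromℕ (k>n⇒nCk≡0 (ℕP.n<1+n n))))) (zeroˡ _))) ⟩
      T 0 + (∑< n Y + 0#)    ≈⟨ +-congˡ (+-identityʳ _) ⟩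
      T 0 + ∑< n Y           ≈⟨ +-congˡ (∑-cong< n (λ i i<n → *-congˡ (*-congˡ (≡⇒≈ (≡.cong g (ℕP.+-∸-assoc 1 i<n)))))) ⟩
      Z 0 + ∑< n (Z ∘ suc)   ≈⟨ ∑-head n Z ⟨
      ∑< (suc n) Z           ≈⟨ ⊛-unfold f (g ∘ suc) n ⟨
      (f ⊛ (g ∘ suc)) n      ∎

  -- D c f is the exponential generating function of (1 + c t) f′(t).
  D : Carrier → Series → Series
  D c f n = f (suc n) + (fromℕ n * c) * f n

  D-leibniz : ∀ c f g → D c (f ⊛ g) ≋ D c f ⊛ g ⊕ f ⊛ D c g
  D-leibniz c f g n = begin
    (f ⊛ g) (suc n) + (fromℕ n * c) * (f ⊛ g) n
      ≈⟨ +-cong (⊛-leibniz f g n) (*-congˡ (⊛-unfold f g n)) ⟩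
    (((f ∘ suc) ⊛ g) n + (f ⊛ (g ∘ suc)) n) + (fromℕ n * c) * ∑< (suc n) Z
      ≈⟨ +-cong (+-cong (⊛-unfold (f ∘ suc) g n) (⊛-unfold f (g ∘ suc) n)) (∑-distribˡ-* (suc n) _ Z) ⟩
    (∑< (suc n) X + ∑< (suc n) Y) + ∑[ i < suc n ] ((fromℕ n * c) * Z i)
      ≈⟨ +-congʳ (∑-distrib-+ (suc n) X Y) ⟨
    ∑[ i < suc n ] (X i + Y i) + ∑[ i < suc n ] ((fromℕ n * c) * Z i)
      ≈⟨ ∑-distrib-+ (suc n) _ _ ⟨
    ∑[ i < suc n ] ((X i + Y i) + (fromℕ n * c) * Z i)
      ≈⟨ ∑-cong< (suc n) (λ i i<1+n → term i (ℕP.≤-pred i<1+n)) ⟩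
    ∑[ i < suc n ] (U i + V i)
      ≈⟨ ∑-distrib-+ (suc n) U V ⟩
    ∑< (suc n) U + ∑< (suc n) V
      ≈⟨ +-cong (⊛-unfold (D c f) g n) (⊛-unfold f (D c g) n) ⟨
    (D c f ⊛ g) n + (f ⊛ D c g) n
      ∎
    where
    X Y Z U V : ℕ → Carrier
    X i = binomial n i * (f (suc i) * g (n ∸ i))
    Y i = binomial n i * (f i * g (suc (n ∸ i)))
    Z i = binomial n i * (f i * g (n ∸ i))
    U i = binomial n i * (D c f i * g (n ∸ i))
    V i = binomial n i * (f i * D c g (n ∸ i))

    -- the weight n splits as i + (n ∸ i) between the two factors
    term : ∀ i → i ≤ n → (X i + Y i) + (fromℕ n * c) * Z i ≈ U i + V i
    term i i≤n = begin
      (X i + Y i) + (fromℕ n * c) * Z i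
        ≈⟨ +-congˡ (*-congʳ (*-congʳ (trans (≡⇒≈ (≡.cong fromℕ (≡.sym (ℕP.m+[n∸m]≡n i≤n))))
                                            (ringFromℕ-+ i (n ∸ i))))) ⟩
      (X i + Y i) + ((fromℕ i + fromℕ (n ∸ i)) * c) * Z i
        ≈⟨ solve 8 (λ C fs fi g0 gs I J c →
             (C :* (fs :* g0) :+ C :* (fi :* gs)) :+ ((I :+ J) :* c) :* (C :* (fi :* g0))
             := C :* ((fs :+ (I :* c) :* fi) :* g0) :+ C :* (fi :* (gs :+ (J :* c) :* g0)))
             refl (binomial n i) (f (suc i)) (f i) (g (n ∸ i)) (g (suc (n ∸ i))) (fromℕ i) (fromℕ (n ∸ i)) c ⟩
      U i + V i
        ∎

  D-oneS : ∀ c → D c oneS ≋ (λ _ → 0#)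
  D-oneS c zero    = trans (+-identityˡ _) (trans (*-congʳ (zeroˡ c)) (zeroˡ _))
  D-oneS c (suc n) = trans (+-identityˡ _) (zeroʳ _)

  D-· : ∀ c a f → D c (a · f) ≋ a · D c f
  D-· c a f n = solve 4 (λ a x k y → a :* x :+ k :* (a :* y) := a :* (x :+ k :* y)) refl a (f (suc n)) (fromℕ n * c) (f n)

  module StirlingMatrix (c d : Carrier) (X : Series) (X₀≈0 : X 0 ≈ 0#) (D-X : D c X ≋ oneS ⊕ d · X) where

    mutual
      D-pow : ∀ m → D c (X ^S suc m) ≋ fromℕ (suc m) · (X ^S m ⊕ d · X ^S suc m)
      D-pow m n = begin
        D c (X ⊛ (X ^S m)) n                                  ≈⟨ D-leibniz c X (X ^S m) n ⟩
        (D c X ⊛ (X ^S m)) n + (X ⊛ D c (X ^S m)) n            ≈⟨ +-cong D[X]⊛X^m (X⊛D[X^m] m n) ⟩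
        (X ^S m ⊕ d · X ^S suc m) n + fromℕ m * (X ^S m ⊕ d · X ^S suc m) n
                                                             ≈⟨ +-congʳ (*-identityˡ _) ⟨
        1# * (X ^S m ⊕ d · X ^S suc m) n + fromℕ m * (X ^S m ⊕ d · X ^S suc m) n
                                                             ≈⟨ distribʳ _ 1# (fromℕ m) ⟨
        fromℕ (suc m) * (X ^S m ⊕ d · X ^S suc m) n          ∎
        where
        D[X]⊛X^m : (D c X ⊛ (X ^S m)) n ≈ (X ^S m ⊕ d · X ^S suc m) n
        D[X]⊛X^m = trans (⊛-cong {g = X ^S m} {g′ = X ^S m} D-X (λ _ → refl) n)
                   (trans (⊛-distribʳ oneS (d · X) (X ^S m) n)
                   (+-cong (⊛-identityˡ (X ^S m) n) (⊛-·ˡ d X (X ^S m) n)))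

      X⊛D[X^m] : ∀ m → X ⊛ D c (X ^S m) ≋ fromℕ m · (X ^S m ⊕ d · X ^S suc m)
      X⊛D[X^m] zero    n = trans (⊛-zeroʳ X (D-oneS c) n) (sym (zeroˡ _))
      X⊛D[X^m] (suc m) n = begin
        (X ⊛ D c (X ^S suc m)) n                                    ≈⟨ ⊛-cong (λ _ → refl) (D-pow m) n ⟩
        (X ⊛ (fromℕ (suc m) · (X ^S m ⊕ d · X ^S suc m))) n          ≈⟨ ⊛-·ʳ (fromℕ (suc m)) X (X ^S m ⊕ d · X ^S suc m) n ⟩
        fromℕ (suc m) * (X ⊛ (X ^S m ⊕ d · X ^S suc m)) n          ≈⟨ *-congˡ (⊛-distribˡ X (X ^S m) (d · X ^S suc m) n) ⟩
        fromℕ (suc m) * ((X ^S suc m) n + (X ⊛ (d · X ^S suc m)) n)  ≈⟨ *-congˡ (+-congˡ (⊛-·ʳ d X (X ^S suc m) n)) ⟩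
        fromℕ (suc m) * (X ^S suc m ⊕ d · X ^S suc (suc m)) n      ∎

    column : ℕ → Series
    column s = factInv s · X ^S s

    D-column-0 : D c (column 0) ≋ (λ _ → 0#)
    D-column-0 n = trans (D-· c (factInv 0) oneS n) (trans (*-congˡ (D-oneS c n)) (zeroʳ _))

    D-column-suc : ∀ s → D c (column (suc s)) ≋ column s ⊕ (fromℕ (suc s) * d) · column (suc s)
    D-column-suc s n = begin
      D c (column (suc s)) n                     ≈⟨ D-· c u (X ^S suc s) n ⟩
      u * D c (X ^S suc s) n                     ≈⟨ *-congˡ (D-pow s n) ⟩
      u * (k * ((X ^S s) n + d * (X ^S suc s) n)) ≈⟨ solve 5 (λ u k a d b → u :* (k :* (a :+ d :* b)) := (u :* k) :* a :+ (k :* d) :* (u :* b)) refl u k ((X ^S s) n) d ((X ^S suc s) n) ⟩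
      (u * k) * (X ^S s) n + (k * d) * column (suc s) n ≈⟨ +-congʳ (*-congʳ (factInv-suc s)) ⟩
      column s n + (k * d) * column (suc s) n    ∎
      where
      u = factInv (suc s)
      k = fromℕ (suc s)

    column-at-0 : ∀ s → column s 0 ≈ δ 0 s
    column-at-0 zero    = trans (*-identityʳ _) factInv-0
    column-at-0 (suc s) = trans (*-congˡ (trans (*-congˡ (trans (*-congʳ X₀≈0) (zeroˡ _))) (zeroʳ _))) (zeroʳ _)

    column-upper : ∀ {r s} → r < s → column s r ≈ 0#
    column-upper {zero}  {suc s} _         = column-at-0 (suc s)
    column-upper {suc r} {suc s} (s≤s r<s) = x+y≈0∧y≈0⇒x≈0 D[col]≈0 (trans (*-congˡ r<s+1) (zeroʳ _))
      where
      r<s+1 = column-upper (ℕP.m<n⇒m<1+n r<s)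
      D[col]≈0 : column (suc s) (suc r) + (fromℕ r * c) * column (suc s) r ≈ 0#
      D[col]≈0 = trans (D-column-suc s r)
                 (trans (+-cong (column-upper r<s) (trans (*-congˡ r<s+1) (zeroʳ _))) (+-identityʳ 0#))

  -- The equations (1 + c t) X′ = 1 + d X and (1 + d t) Y′ = 1 + c Y force X ∘ Y = t,
  -- so the Stirling matrices of X and Y are mutually inverse.
  module Inversion (c d : Carrier) (X Y : Series) (X₀≈0 : X 0 ≈ 0#) (Y₀≈0 : Y 0 ≈ 0#)
                   (D-X : D c X ≋ oneS ⊕ d · X) (D-Y : D d Y ≋ oneS ⊕ c · Y) where

    module SX = StirlingMatrix c d X X₀≈0 D-X
    module SY = StirlingMatrix d c Y Y₀≈0 D-Y

    A B : ℕ → ℕ → Carrier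
    A r s = SX.column s r
    B r s = SY.column s r

    BA : ℕ → ℕ → ℕ → Carrier
    BA N j m = ∑[ k < N ] (A k m * B j k)

    BA-step : ∀ {N j} → suc j < N → ∀ m →
              BA N (suc j) m + (fromℕ j * d) * BA N j m ≈ ∑[ k < N ] (D c (SX.column m) k * B j k)
    BA-step {suc n} {j} 1+j<N m = begin
      BA N (suc j) m + (fromℕ j * d) * BA N j m
        ≈⟨ +-congˡ (∑-distribˡ-* N _ _) ⟩
      BA N (suc j) m + ∑[ k < N ] ((fromℕ j * d) * (A k m * B j k))
        ≈⟨ ∑-distrib-+ N _ _ ⟨
      ∑[ k < N ] (A k m * B (suc j) k + (fromℕ j * d) * (A k m * B j k))
        ≈⟨ ∑-cong N (λ k → solve 4 (λ a b c e → a :* b :+ c :* (a :* e) := a :* (b :+ c :* e)) refl (A k m) (B (suc j) k) (fromℕ j * d) (B j k)) ⟩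
      ∑[ k < N ] (A k m * D d (SY.column k) j)
        ≈⟨ ∑-head n _ ⟩
      A 0 m * D d (SY.column 0) j + ∑[ k < n ] (A (suc k) m * D d (SY.column (suc k)) j)
        ≈⟨ +-cong (trans (*-congˡ (SY.D-column-0 j)) (zeroʳ _)) (∑-cong n (λ k → *-congˡ (SY.D-column-suc k j))) ⟩
      0# + ∑[ k < n ] (A (suc k) m * (B j k + (fromℕ (suc k) * c) * B j (suc k)))
        ≈⟨ +-identityˡ _ ⟩
      ∑[ k < n ] (A (suc k) m * (B j k + (fromℕ (suc k) * c) * B j (suc k)))
        ≈⟨ ∑-cong n (λ k → solve 4 (λ a b c e → a :* (b :+ c :* e) := a :* b :+ (c :* a) :* e) refl (A (suc k) m) (B j k) (fromℕ (suc k) * c) (B j (suc k))) ⟩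
      ∑[ k < n ] (A (suc k) m * B j k + ((fromℕ (suc k) * c) * A (suc k) m) * B j (suc k))
        ≈⟨ ∑-distrib-+ n _ _ ⟩
      ∑[ k < n ] (A (suc k) m * B j k) + ∑[ k < n ] (((fromℕ (suc k) * c) * A (suc k) m) * B j (suc k))
        ≈⟨ +-cong extend reindex ⟩
      ∑[ k < N ] (A (suc k) m * B j k) + ∑[ k < N ] (((fromℕ k * c) * A k m) * B j k)
        ≈⟨ ∑-distrib-+ N _ _ ⟨
      ∑[ k < N ] (A (suc k) m * B j k + ((fromℕ k * c) * A k m) * B j k)
        ≈⟨ ∑-cong N (λ k → sym (distribʳ _ _ _)) ⟩
      ∑[ k < N ] (D c (SX.column m) k * B j k)
        ∎
      where
      N = suc n
      extend : ∑[ k < n ] (A (suc k) m * B j k) ≈ ∑[ k < N ] (A (suc k) m * B j k)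
      extend = sym (trans (+-congˡ (trans (*-congˡ (SY.column-upper (ℕP.≤-pred 1+j<N))) (zeroʳ _)))
                          (+-identityʳ _))
      reindex : ∑[ k < n ] (((fromℕ (suc k) * c) * A (suc k) m) * B j (suc k))
              ≈ ∑[ k < N ] (((fromℕ k * c) * A k m) * B j k)
      reindex = sym (trans (∑-head n _)
                    (trans (+-congʳ (trans (*-congʳ (trans (*-congʳ (zeroˡ c)) (zeroˡ _))) (zeroˡ _)))
                           (+-identityˡ _)))

    BA≈δ : ∀ {N} j → j < N → ∀ m → BA N j m ≈ δ j m
    BA≈δ {suc n} zero _ m = begin
      BA (suc n) 0 m                                    ≈⟨ ∑-head n _ ⟩
      A 0 m * B 0 0 + ∑[ k < n ] (A (suc k) m * B 0 (suc k))
        ≈⟨ +-cong (trans (*-congˡ (SY.column-at-0 0)) (*-identityʳ _))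
                  (∑-zero n (λ k _ → trans (*-congˡ (SY.column-at-0 (suc k))) (zeroʳ _))) ⟩
      A 0 m + 0#                                        ≈⟨ +-identityʳ _ ⟩
      A 0 m                                             ≈⟨ SX.column-at-0 m ⟩
      δ 0 m                                             ∎
    BA≈δ {N} (suc j) 1+j<N zero = x+y≈0∧y≈0⇒x≈0 step (trans (*-δ-swap (λ i → fromℕ i * d) j 0) (trans (*-congʳ (zeroˡ d)) (zeroˡ _)))
      where
      step : BA N (suc j) 0 + (fromℕ j * d) * δ j 0 ≈ 0#
      step = trans (+-congˡ (*-congˡ (sym (BA≈δ j (ℕP.<-trans (ℕP.n<1+n j) 1+j<N) 0))))
             (trans (BA-step 1+j<N 0)
                    (∑-zero N (λ k _ → trans (*-congʳ (SX.D-column-0 k)) (zeroˡ _))))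
    BA≈δ {N} (suc j) 1+j<N (suc m) = +-cancelʳ _ _ _ step
      where
      IH = BA≈δ j (ℕP.<-trans (ℕP.n<1+n j) 1+j<N)
      e = fromℕ (suc m) * d
      step : BA N (suc j) (suc m) + e * δ j (suc m) ≈ δ j m + e * δ j (suc m)
      step = begin
        BA N (suc j) (suc m) + e * δ j (suc m)
          ≈⟨ +-congˡ (*-δ-swap (λ i → fromℕ i * d) j (suc m)) ⟨
        BA N (suc j) (suc m) + (fromℕ j * d) * δ j (suc m)
          ≈⟨ +-congˡ (*-congˡ (IH (suc m))) ⟨
        BA N (suc j) (suc m) + (fromℕ j * d) * BA N j (suc m)
          ≈⟨ BA-step 1+j<N (suc m) ⟩
        ∑[ k < N ] (D c (SX.column (suc m)) k * B j k)
          ≈⟨ ∑-cong N (λ k → *-congʳ (SX.D-column-suc m k)) ⟩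
        ∑[ k < N ] ((A k m + e * A k (suc m)) * B j k)
          ≈⟨ ∑-cong N (λ k → solve 4 (λ a c e b → (a :+ c :* e) :* b := a :* b :+ c :* (e :* b)) refl (A k m) e (A k (suc m)) (B j k)) ⟩
        ∑[ k < N ] (A k m * B j k + e * (A k (suc m) * B j k))
          ≈⟨ ∑-distrib-+ N _ _ ⟩
        BA N j m + ∑[ k < N ] (e * (A k (suc m) * B j k))
          ≈⟨ +-congˡ (∑-distribˡ-* N e _) ⟨
        BA N j m + e * BA N j (suc m)
          ≈⟨ +-cong (IH m) (*-congˡ (IH (suc m))) ⟩
        δ j m + e * δ j (suc m)
          ∎

  coeff-+ₚ : ∀ p q i → coeff (p +ₚ q) i ≈ coeff p i + coeff q i
  coeff-+ₚ []      q       i       = sym (+-identityˡ _)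
  coeff-+ₚ (a ∷ p) []      i       = sym (+-identityʳ _)
  coeff-+ₚ (a ∷ p) (b ∷ q) zero    = refl
  coeff-+ₚ (a ∷ p) (b ∷ q) (suc i) = coeff-+ₚ p q i

  coeff-·ₚ : ∀ a p i → coeff (a ·ₚ p) i ≈ a * coeff p i
  coeff-·ₚ a []      i       = sym (zeroʳ a)
  coeff-·ₚ a (b ∷ p) zero    = refl
  coeff-·ₚ a (b ∷ p) (suc i) = coeff-·ₚ a p i

  coeff-sumₚ-applyUpTo : ∀ (g : ℕ → Poly) (h : ℕ → ℕ) n i →
                         coeff (sumₚ (map g (applyUpTo h n))) i ≈ ∑[ k < n ] coeff (g (h k)) i
  coeff-sumₚ-applyUpTo g h zero    i = refl
  coeff-sumₚ-applyUpTo g h (suc n) i = begin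
    coeff (g (h 0) +ₚ sumₚ (map g (applyUpTo (h ∘ suc) n))) i           ≈⟨ coeff-+ₚ (g (h 0)) _ i ⟩
    coeff (g (h 0)) i + coeff (sumₚ (map g (applyUpTo (h ∘ suc) n))) i  ≈⟨ +-congˡ (coeff-sumₚ-applyUpTo g (h ∘ suc) n i) ⟩
    coeff (g (h 0)) i + ∑[ k < n ] coeff (g (h (suc k))) i               ≈⟨ ∑-head n (λ k → coeff (g (h k)) i) ⟨
    ∑[ k < suc n ] coeff (g (h k)) i                                     ∎

  coeff-≥length : ∀ p {i} → length p ≤ i → coeff p i ≈ 0#
  coeff-≥length []      _           = refl
  coeff-≥length (a ∷ p) (s≤s len≤i) = coeff-≥length p len≤i

  module FallingFactorialBasis (lam : Carrier) where

    falling : ℕ → ℕ → Carrier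
    falling j i = coeff (fallPoly lam j) i

    coeff-x*falling : ∀ j i → coeff (0# ∷ fallPoly lam j) i ≈ falling (suc j) i + (fromℕ j * lam) * falling j i
    coeff-x*falling j i = sym (begin
      falling (suc j) i + a * falling j i
        ≈⟨ +-congʳ (coeff-+ₚ (0# ∷ fallPoly lam j) ((- a) ·ₚ fallPoly lam j) i) ⟩
      (coeff (0# ∷ fallPoly lam j) i + coeff ((- a) ·ₚ fallPoly lam j) i) + a * falling j i
        ≈⟨ +-congʳ (+-congˡ (coeff-·ₚ (- a) (fallPoly lam j) i)) ⟩
      (coeff (0# ∷ fallPoly lam j) i + (- a) * falling j i) + a * falling j i
        ≈⟨ +-assoc _ _ _ ⟩
      coeff (0# ∷ fallPoly lam j) i + ((- a) * falling j i + a * falling j i)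
        ≈⟨ +-congˡ (-x*y+x*y≈0 a (falling j i)) ⟩
      coeff (0# ∷ fallPoly lam j) i + 0#
        ≈⟨ +-identityʳ _ ⟩
      coeff (0# ∷ fallPoly lam j) i
        ∎)
      where a = fromℕ j * lam

    -- mulXcoords and pairing are defined through local workers that cannot be named
    -- here; the following copies are identified with them by abstracting over the
    -- worker's arguments.
    mulXcoordsFrom : List Carrier → ℕ → List Carrier → List Carrier
    mulXcoordsFrom cs j []       = []
    mulXcoordsFrom cs j (d ∷ ds) = (d + (fromℕ j * lam) * coeff cs j) ∷ mulXcoordsFrom cs (suc j) ds

    mulXcoordsFrom-unique : (G : List Carrier → ℕ → List Carrier → List Carrier) →
      (∀ cs j → G cs j [] ≡ []) →
      (∀ cs j d ds → G cs j (d ∷ ds) ≡ (d + (fromℕ j * lam) * coeff cs j) ∷ G cs (suc j) ds) →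
      ∀ cs j ds → G cs j ds ≡ mulXcoordsFrom cs j ds
    mulXcoordsFrom-unique G G[] G∷ cs j []       = G[] cs j
    mulXcoordsFrom-unique G G[] G∷ cs j (d ∷ ds) =
      ≡.trans (G∷ cs j d ds) (≡.cong (_ ∷_) (mulXcoordsFrom-unique G G[] G∷ cs (suc j) ds))

    mulXcoords≡ : ∀ cs → mulXcoords lam cs ≡ mulXcoordsFrom cs 0 (0# ∷ cs)
    mulXcoords≡ []       = ≡.refl
    mulXcoords≡ (c ∷ cs) with mulXcoordsFrom-unique _ (λ _ _ → ≡.refl) (λ _ _ _ _ → ≡.refl) | cs | c ∷ cs | 2
    ... | unique | ds | c∷ds | two = ≡.cong₂ _∷_ ≡.refl (≡.cong₂ _∷_ ≡.refl (unique c∷ds two ds))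

    pairingFrom : Series → ℕ → List Carrier → Carrier
    pairingFrom f k []       = 0#
    pairingFrom f k (c ∷ cs) = f k * c + pairingFrom f (suc k) cs

    pairingFrom-unique : (f : Series) (G : ℕ → List Carrier → Carrier) →
      (∀ k → G k [] ≡ 0#) → (∀ k c cs → G k (c ∷ cs) ≡ f k * c + G (suc k) cs) →
      ∀ k cs → G k cs ≡ pairingFrom f k cs
    pairingFrom-unique f G G[] G∷ k []       = G[] k
    pairingFrom-unique f G G[] G∷ k (c ∷ cs) =
      ≡.trans (G∷ k c cs) (≡.cong (f k * c +_) (pairingFrom-unique f G G[] G∷ (suc k) cs))

    pairing≡ : ∀ f p → pairing lam f p ≡ pairingFrom f 0 (fallCoords lam p)
    pairing≡ f p with pairingFrom-unique f _ (λ _ → ≡.refl) (λ _ _ _ → ≡.refl) | fallCoords lam p | 0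
    ... | unique | cs | zero′ = unique zero′ cs

    coeff-mulXcoordsFrom : ∀ cs j ds → length cs ≤ j ℕ.+ length ds → ∀ i →
      coeff (mulXcoordsFrom cs j ds) i ≈ coeff ds i + (fromℕ (j ℕ.+ i) * lam) * coeff cs (j ℕ.+ i)
    coeff-mulXcoordsFrom cs j [] len≤j i = sym (begin
      0# + (fromℕ (j ℕ.+ i) * lam) * coeff cs (j ℕ.+ i)
        ≈⟨ +-congˡ (*-congˡ (coeff-≥length cs (ℕP.≤-trans len≤j (ℕP.≤-trans (ℕP.≤-reflexive (ℕP.+-identityʳ j)) (ℕP.m≤m+n j i))))) ⟩
      0# + (fromℕ (j ℕ.+ i) * lam) * 0#  ≈⟨ +-identityˡ _ ⟩
      (fromℕ (j ℕ.+ i) * lam) * 0#       ≈⟨ zeroʳ _ ⟩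
      0#                                 ∎)
    coeff-mulXcoordsFrom cs j (d ∷ ds) len≤j zero    rewrite ℕP.+-identityʳ j = refl
    coeff-mulXcoordsFrom cs j (d ∷ ds) len≤j (suc i) rewrite ℕP.+-suc j i =
      coeff-mulXcoordsFrom cs (suc j) ds (ℕP.≤-trans len≤j (ℕP.≤-reflexive (ℕP.+-suc j (length ds)))) i

    coeff-mulXcoords : ∀ cs i → coeff (mulXcoords lam cs) i ≈ coeff (0# ∷ cs) i + (fromℕ i * lam) * coeff cs i
    coeff-mulXcoords cs i rewrite mulXcoords≡ cs = coeff-mulXcoordsFrom cs 0 (0# ∷ cs) (ℕP.n≤1+n _) i

    coeff-fallCoords-∷ : ∀ a q j → coeff (fallCoords lam (a ∷ q)) j ≈
      coeff (a ∷ []) j + (coeff (0# ∷ fallCoords lam q) j + (fromℕ j * lam) * coeff (fallCoords lam q) j)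
    coeff-fallCoords-∷ a q j =
      trans (coeff-+ₚ (a ∷ []) (mulXcoords lam (fallCoords lam q)) j) (+-congˡ (coeff-mulXcoords (fallCoords lam q) j))

    coeff-fallCoords-≥length : ∀ p {m} → length p ≤ m → coeff (fallCoords lam p) m ≈ 0#
    coeff-fallCoords-≥length []      _                = refl
    coeff-fallCoords-≥length (a ∷ q) {suc m} (s≤s len≤m) = begin
      coeff (fallCoords lam (a ∷ q)) (suc m)
        ≈⟨ coeff-fallCoords-∷ a q (suc m) ⟩
      0# + (coeff (fallCoords lam q) m + (fromℕ (suc m) * lam) * coeff (fallCoords lam q) (suc m))
        ≈⟨ +-congˡ (+-cong (coeff-fallCoords-≥length q len≤m)
                           (*-congˡ (coeff-fallCoords-≥length q (ℕP.m≤n⇒m≤1+n len≤m)))) ⟩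
      0# + (0# + (fromℕ (suc m) * lam) * 0#)
        ≈⟨ trans (+-identityˡ _) (trans (+-identityˡ _) (zeroʳ _)) ⟩
      0#
        ∎

    mulXcoords-expand : ∀ N cs i → coeff cs N ≈ 0# →
      ∑[ j < suc N ] (coeff (mulXcoords lam cs) j * falling j i) ≈ ∑[ j < N ] (coeff cs j * coeff (0# ∷ fallPoly lam j) i)
    mulXcoords-expand N cs i csN≈0 = begin
      ∑[ j < suc N ] (coeff (mulXcoords lam cs) j * falling j i)
        ≈⟨ ∑-cong (suc N) (λ j → trans (*-congʳ (coeff-mulXcoords cs j)) (distribʳ _ _ _)) ⟩
      ∑[ j < suc N ] (coeff (0# ∷ cs) j * falling j i + ((fromℕ j * lam) * coeff cs j) * falling j i)
        ≈⟨ ∑-distrib-+ (suc N) _ _ ⟩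
      ∑[ j < suc N ] (coeff (0# ∷ cs) j * falling j i) + ∑[ j < suc N ] (((fromℕ j * lam) * coeff cs j) * falling j i)
        ≈⟨ +-cong shifted last ⟩
      ∑[ j < N ] (coeff cs j * falling (suc j) i) + ∑[ j < N ] (((fromℕ j * lam) * coeff cs j) * falling j i)
        ≈⟨ ∑-distrib-+ N _ _ ⟨
      ∑[ j < N ] (coeff cs j * falling (suc j) i + ((fromℕ j * lam) * coeff cs j) * falling j i)
        ≈⟨ ∑-cong N (λ j → solve 4 (λ c f a g → c :* f :+ (a :* c) :* g := c :* (f :+ a :* g)) refl
                                   (coeff cs j) (falling (suc j) i) (fromℕ j * lam) (falling j i)) ⟩
      ∑[ j < N ] (coeff cs j * (falling (suc j) i + (fromℕ j * lam) * falling j i))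
        ≈⟨ ∑-cong N (λ j → *-congˡ (coeff-x*falling j i)) ⟨
      ∑[ j < N ] (coeff cs j * coeff (0# ∷ fallPoly lam j) i)
        ∎
      where
      shifted : ∑[ j < suc N ] (coeff (0# ∷ cs) j * falling j i) ≈ ∑[ j < N ] (coeff cs j * falling (suc j) i)
      shifted = trans (∑-head N _) (trans (+-congʳ (zeroˡ _)) (+-identityˡ _))
      last : ∑[ j < suc N ] (((fromℕ j * lam) * coeff cs j) * falling j i) ≈ ∑[ j < N ] (((fromℕ j * lam) * coeff cs j) * falling j i)
      last = trans (+-congˡ (trans (*-congʳ (trans (*-congˡ csN≈0) (zeroʳ _))) (zeroˡ _))) (+-identityʳ _)

    fallCoords-expand : ∀ p {N} → length p ≤ N → ∀ i →
                        coeff p i ≈ ∑[ j < N ] (coeff (fallCoords lam p) j * falling j i)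
    fallCoords-expand []      {N}     _           i = sym (∑-zero N (λ _ _ → zeroˡ _))
    fallCoords-expand (a ∷ q) {suc N} (s≤s len≤N) i = sym (begin
      ∑[ j < suc N ] (coeff (fallCoords lam (a ∷ q)) j * falling j i)
        ≈⟨ ∑-cong (suc N) (λ j → trans (*-congʳ (coeff-+ₚ (a ∷ []) (mulXcoords lam cs) j)) (distribʳ _ _ _)) ⟩
      ∑[ j < suc N ] (coeff (a ∷ []) j * falling j i + coeff (mulXcoords lam cs) j * falling j i)
        ≈⟨ ∑-distrib-+ (suc N) _ _ ⟩
      ∑[ j < suc N ] (coeff (a ∷ []) j * falling j i) + ∑[ j < suc N ] (coeff (mulXcoords lam cs) j * falling j i)
        ≈⟨ +-cong constant (mulXcoords-expand N cs i (coeff-fallCoords-≥length q len≤N)) ⟩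
      a * falling 0 i + ∑[ j < N ] (coeff cs j * coeff (0# ∷ fallPoly lam j) i)
        ≈⟨ horner i ⟩
      coeff (a ∷ q) i
        ∎)
      where
      cs = fallCoords lam q
      constant : ∑[ j < suc N ] (coeff (a ∷ []) j * falling j i) ≈ a * falling 0 i
      constant = trans (∑-head N _) (trans (+-congˡ (∑-zero N (λ _ _ → zeroˡ _))) (+-identityʳ _))
      horner : ∀ i → a * falling 0 i + ∑[ j < N ] (coeff cs j * coeff (0# ∷ fallPoly lam j) i) ≈ coeff (a ∷ q) i
      horner zero    = trans (+-cong (*-identityʳ a) (∑-zero N (λ _ _ → zeroʳ _))) (+-identityʳ a)
      horner (suc i) = trans (+-cong (zeroʳ a) (sym (fallCoords-expand q len≤N i))) (+-identityˡ _)

    pairingFrom-∑ : ∀ f k cs → pairingFrom f k cs ≈ ∑[ j < length cs ] (f (k ℕ.+ j) * coeff cs j)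
    pairingFrom-∑ f k []       = refl
    pairingFrom-∑ f k (c ∷ cs) = begin
      f k * c + pairingFrom f (suc k) cs
        ≈⟨ +-congˡ (pairingFrom-∑ f (suc k) cs) ⟩
      f k * c + ∑[ j < length cs ] (f (suc k ℕ.+ j) * coeff cs j)
        ≈⟨ +-cong (≡⇒≈ (≡.cong (λ m → f m * c) (≡.sym (ℕP.+-identityʳ k))))
                  (∑-cong (length cs) (λ j → ≡⇒≈ (≡.cong (λ m → f m * coeff cs j) (≡.sym (ℕP.+-suc k j))))) ⟩
      f (k ℕ.+ 0) * c + ∑[ j < length cs ] (f (k ℕ.+ suc j) * coeff cs j)
        ≈⟨ ∑-head (length cs) (λ j → f (k ℕ.+ j) * coeff (c ∷ cs) j) ⟨
      ∑[ j < suc (length cs) ] (f (k ℕ.+ j) * coeff (c ∷ cs) j)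
        ∎

    pairing-∑ : ∀ f p {N} → length p ≤ N → pairing lam f p ≈ ∑[ j < N ] (f j * coeff (fallCoords lam p) j)
    pairing-∑ f p {N} len≤N = begin
      pairing lam f p                                  ≡⟨ pairing≡ f p ⟩
      pairingFrom f 0 cs                               ≈⟨ pairingFrom-∑ f 0 cs ⟩
      ∑[ j < length cs ] (f j * coeff cs j)
        ≈⟨ ∑-support (length cs) N _ (λ m len≤m → trans (*-congˡ (coeff-≥length cs len≤m)) (zeroʳ _))
                     (λ m N≤m → trans (*-congˡ (coeff-fallCoords-≥length p (ℕP.≤-trans len≤N N≤m))) (zeroʳ _)) ⟩
      ∑[ j < N ] (f j * coeff cs j)                    ∎
      where cs = fallCoords lam p

  module DegenerateBell (lam : Carrier) (lam≉0 : ¬ (lam ≈ 0#)) where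
    open FallingFactorialBasis lam public

    E L : Series
    E = eλm1 lam
    L = logλ lam

    x+-[0*y]≈x : ∀ x y → x + - (0# * y) ≈ x
    x+-[0*y]≈x x y = trans (+-congˡ (trans (-‿cong (zeroˡ y)) -0#≈0#)) (+-identityʳ x)

    D-E : D lam E ≋ oneS ⊕ 1# · E
    D-E zero = begin
      1# * (1# + - (0# * lam)) + (0# * lam) * 0#  ≈⟨ +-cong (trans (*-identityˡ _) (x+-[0*y]≈x 1# lam)) (zeroʳ _) ⟩
      1# + 0#                                     ≈⟨ +-congˡ (zeroʳ 1#) ⟨
      1# + 1# * 0#                                ∎
    D-E (suc k) = begin
      E (suc k) * (1# + - a) + a * E (suc k)  ≈⟨ x[y+-a]+a*x≈x*y (E (suc k)) 1# a ⟩
      E (suc k) * 1#                          ≈⟨ *-comm _ _ ⟩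
      1# * E (suc k)                          ≈⟨ +-identityˡ _ ⟨
      0# + 1# * E (suc k)                     ∎
      where a = fromℕ (suc k) * lam

    L₀≈0 : L 0 ≈ 0#
    L₀≈0 = trans (*-congˡ (-‿inverseʳ 1#)) (zeroʳ _)

    D-L : D 1# L ≋ oneS ⊕ lam · L
    D-L zero = begin
      L 1 + (0# * 1#) * L 0  ≈⟨ +-cong L₁≈1 (trans (*-congˡ L₀≈0) (zeroʳ _)) ⟩
      1# + 0#                ≈⟨ +-congˡ (trans (*-congˡ L₀≈0) (zeroʳ _)) ⟨
      1# + lam * L 0         ∎
      where
      L₁≈1 : L 1 ≈ 1#
      L₁≈1 = trans (*-congˡ (trans (*-identityˡ _) (x+-[0*y]≈x lam 1#))) (trans (*-comm _ _) (inverseʳ lam lam≉0))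
    D-L (suc k) = begin
      lam ⁻¹ * (P * (lam + - a)) + a * L (suc k)  ≈⟨ +-congʳ (*-assoc _ _ _) ⟨
      L (suc k) * (lam + - a) + a * L (suc k)     ≈⟨ x[y+-a]+a*x≈x*y (L (suc k)) lam a ⟩
      L (suc k) * lam                             ≈⟨ *-comm _ _ ⟩
      lam * L (suc k)                             ≈⟨ +-identityˡ _ ⟨
      0# + lam * L (suc k)                        ∎
      where
      P = fall lam 1# (suc k)
      a = fromℕ (suc k) * 1#

    open Inversion lam 1# E L refl L₀≈0 D-E D-L public

    Ccoef-∑ : ∀ p {N} → length p ≤ N → ∀ k →
              Ccoef lam k p ≈ ∑[ j < N ] (B j k * coeff (fallCoords lam p) j)
    Ccoef-∑ p {N} len≤N k = begin
      factInv k * pairing lam (L ^S k) p                   ≈⟨ *-congˡ (pairing-∑ (L ^S k) p len≤N) ⟩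
      factInv k * ∑[ j < N ] ((L ^S k) j * cs j)           ≈⟨ ∑-distribˡ-* N _ _ ⟩
      ∑[ j < N ] (factInv k * ((L ^S k) j * cs j))         ≈⟨ ∑-cong N (λ j → sym (*-assoc _ _ _)) ⟩
      ∑[ j < N ] (B j k * cs j)                            ∎
      where cs = coeff (fallCoords lam p)

    coeff-φ : ∀ {N k} → k < N → ∀ i → coeff (φ lam k) i ≈ ∑[ m < N ] (A k m * falling m i)
    coeff-φ {N} {k} k<N i = begin
      coeff (φ lam k) i
        ≈⟨ coeff-sumₚ-applyUpTo (λ m → (factInv m * (E ^S m) k) ·ₚ fallPoly lam m) (λ m → m) (suc k) i ⟩
      ∑[ m < suc k ] coeff ((factInv m * (E ^S m) k) ·ₚ fallPoly lam m) i
        ≈⟨ ∑-cong (suc k) (λ m → coeff-·ₚ _ (fallPoly lam m) i) ⟩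
      ∑[ m < suc k ] (A k m * falling m i)
        ≈⟨ ∑-extend _ k<N (λ m k<m _ → trans (*-congʳ (SX.column-upper k<m)) (zeroˡ _)) ⟨
      ∑[ m < N ] (A k m * falling m i)
        ∎

theorem4 : ∀ {c ℓ} (F : CharZeroField c ℓ) → let open Ops F in
           (lam : Carrier) → ¬ (lam ≈ 0#) → (n : ℕ) → (p : Poly) → length p ≤ suc n →
           p ≈ₚ sumₚ (map (λ k → Ccoef lam k p ·ₚ φ lam k) (upTo (suc n)))
theorem4 F lam lam≉0 n p len≤N i = sym (begin
  coeff (sumₚ (map (λ k → Ccoef lam k p ·ₚ φ lam k) (upTo N))) i
    ≈⟨ coeff-sumₚ-applyUpTo F (λ k → Ccoef lam k p ·ₚ φ lam k) (λ k → k) N i ⟩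
  ∑[ k < N ] coeff (Ccoef lam k p ·ₚ φ lam k) i
    ≈⟨ ∑-cong N (λ k → coeff-·ₚ F _ (φ lam k) i) ⟩
  ∑[ k < N ] (Ccoef lam k p * coeff (φ lam k) i)
    ≈⟨ ∑-cong< N (λ k k<N → *-cong (Ccoef-∑ p len≤N k) (coeff-φ k<N i)) ⟩
  ∑[ k < N ] ((∑[ j < N ] (B j k * cs j)) * (∑[ m < N ] (A k m * falling m i)))
    ≈⟨ ∑-sandwich N cs (λ m → falling m i) A B ⟩
  ∑[ j < N ] ∑[ m < N ] ((cs j * falling m i) * BA N j m)
    ≈⟨ ∑-cong< N (λ j j<N → ∑-cong N (λ m → trans (*-congˡ (BA≈δ j j<N m)) (*-comm _ _))) ⟩
  ∑[ j < N ] ∑[ m < N ] (δ j m * (cs j * falling m i))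
    ≈⟨ ∑-cong< N (λ j j<N → ∑-δ N j (λ m → cs j * falling m i) j<N) ⟩
  ∑[ j < N ] (cs j * falling j i)
    ≈⟨ fallCoords-expand p len≤N i ⟨
  coeff p i
    ∎)
  where
  open Ops F hiding (zero)
  open CommutativeRingProperties commutativeRing
  open DegenerateBell F lam lam≉0
  open import Relation.Binary.Reasoning.Setoid setoid
  N = suc n
  cs = coeff (fallCoords lam p)
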